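{- For integers $r,p$ with $r\ge 0$ and every integer $n\ge0$, $$\beta_{n,\lambda}^{(p)}(-r)=(-1)^{n}\sum_{k=0}^{n}\frac{\lambda^{k}(1)_{k+1,1/\lambda}}{(k+1)^{p}}\sum_{j=0}^{n}\binom{n}{j}S_{2,\lambda}(j,k)(r)_{n-j,\lambda}=(-1)^{n}\sum_{k=0}^{n}\frac{\lambda^{k}(1)_{k+1,1/\lambda}}{(k+1)^{p}}S_{2,\lambda}^{(r)}(n+r,k+r).$$
   Context: Let $\lambda$ be a nonzero real number. For $\mu\in\mathbb{R}$, $(x)_{0,\mu}=1$, $(x)_{n,\mu}=x(x-\mu)\cdots(x-(n-1)\mu)$ for $n\ge1$, and $e_\mu^x(t)=\sum_{k\ge0}(x)_{k,\mu}t^k/k!$ (formal power series in $t$), $e_\mu(t)=e_\mu^1(t)$; $(x)_k=x(x-1)\cdots(x-k+1)$. The degenerate Stirling numbers of the second kind are defined by $(x)_{n,\lambda}=\sum_{k=0}^n S_{2,\lambda}(n,k)(x)_k$ (with $S_{2,\lambda}(n,k)=0$ for $k>n$), and for an integer $r\ge0$ the degenerate $r$-Stirling numbers of the second kind by $(x+r)_{n,\lambda}=\sum_{k=0}^n S^{(r)}_{2,\lambda}(n+r,k+r)(x)_k$. For $k\in\mathbb{Z}$, the degenerate polylogarithm is $\mathrm{Li}_{k,\lambda}(y)=\sum_{n\ge1}\frac{(-\lambda)^{n-1}(1)_{n,1/\lambda}}{(n-1)!\,n^k}y^n$. The degenerate poly-Bernoulli polynomials of index $k$ are defined by $\frac{\mathrm{Li}_{k,\lambda}(1-e_\lambda(-t))}{1-e_\lambda(-t)}e_\lambda^{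 -x}(-t)=\sum_{n\ge0}\beta^{(k)}_{n,\lambda}(x)\frac{t^n}{n!}$.
   Formalization: The parameter λ ranges over the nonzero rationals rather than the nonzero reals, and x in the defining expansions of the degenerate Stirling numbers is taken over the rationals. -}

module Defs where

open import Data.Nat as ℕ using (ℕ; zero; suc; _∸_; _!)
open import Data.Nat.Properties using (m^n≢0; _!≢0)
open import Data.Nat.Combinatorics using (_C_)
open import Data.Integer as ℤ using (ℤ; +_; -[1+_])
open import Data.Rational using (ℚ; 0ℚ; 1ℚ; _+_; _*_; _-_; -_; _/_; 1/_; NonZero)

ℕ→ℚ : ℕ → ℚ
ℕ→ℚ n = (+ n) / 1

_^ℕ_ : ℚ → ℕ → ℚ
x ^ℕ zero = 1ℚ
x ^ℕ suc n = x * (x ^ℕ n)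

inv! : ℕ → ℚ
inv! k = (+ 1) / (k !)
  where instance _ = k !≢0

-- divPow c k p = c / (k+1)^p  for an integer exponent p
divPow : ℚ → ℕ → ℤ → ℚ
divPow c k (+ m) = c * ((+ 1) / (suc k ℕ.^ m))
  where instance _ = m^n≢0 (suc k) m
divPow c k -[1+ m ] = c * (ℕ→ℚ (suc k) ^ℕ suc m)

Σ≤ : ℕ → (ℕ → ℚ) → ℚ
Σ≤ zero f = f 0
Σ≤ (suc n) f = Σ≤ n f + f (suc n)

-- generalized falling factorial (x)_{n,μ} = x(x-μ)...(x-(n-1)μ);  fall μ x n
fall : ℚ → ℚ → ℕ → ℚ
fall μ x zero = 1ℚ
fall μ x (suc n) = fall μ x n * (x - ℕ→ℚ n * μ)

Series : Set
Series = ℕ → ℚ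

one : Series
one zero = 1ℚ
one (suc _) = 0ℚ

_⊖_ : Series → Series → Series
(f ⊖ g) n = f n - g n

_⊛_ : Series → Series → Series
(f ⊛ g) n = Σ≤ n (λ j → f j * g (n ∸ j))

_^S_ : Series → ℕ → Series
g ^S zero = one
g ^S suc m = g ⊛ (g ^S m)

-- formal composition f(g(t)), meaningful when g has zero constant term
-- (then g^m has order ≥ m, so the coefficient sum is finite):
-- [t^N] f(g) = Σ_{m=0}^{N} f_m [t^N] g^m
compose : Series → Series → Series
compose f g N = Σ≤ N (λ m → f m * (g ^S m) N)

negT : Series → Series
negT f k = ((- 1ℚ) ^ℕ k) * f k

eSeries : ℚ → ℚ → Series
eSeries μ x k = fall μ x k * inv! k

ySeries : ℚ → Series
ySeries lam = one ⊖ negT (eSeries lam 1ℚ)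

-- The power series (in u) of Li_{k,λ}(u)/u:
-- Li_{k,λ}(u) = Σ_{n≥1} (-λ)^{n-1} (1)_{n,1/λ} / ((n-1)! n^k) u^n,
-- so the coefficient of u^m in Li_{k,λ}(u)/u is the n = m+1 coefficient.
LiOverU : (lam : ℚ) → .{{NonZero lam}} → ℤ → Series
LiOverU lam k m =
  divPow (((- lam) ^ℕ m) * fall (1/ lam) 1ℚ (suc m) * inv! m) m k

-- generating function  Li_{k,λ}(1-e_λ(-t))/(1-e_λ(-t)) · e_λ^{-x}(-t)
βGen : (lam : ℚ) → .{{NonZero lam}} → ℤ → ℚ → Series
βGen lam k x = compose (LiOverU lam k) (ySeries lam) ⊛ negT (eSeries lam (- x))

polyBernoulli : (lam : ℚ) → .{{NonZero lam}} → ℤ → ℕ → ℚ → ℚ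
polyBernoulli lam k n x = ℕ→ℚ (n !) * βGen lam k x n

binom : ℕ → ℕ → ℚ
binom n j = ℕ→ℚ (n C j)

-- Write egfCoeff f n = n! [tⁿ] f, so that egfCoeff (f ⊛ g) is the binomial convolution of
-- egfCoeff f and egfCoeff g. For y = 1 - e_λ(-t) one shows
--   egfCoeff (yᵐ) N = (-1)^(m+N) m! S_{2,λ}(N,m)
-- by induction on m, the inductive step being the recurrence
--   Σ_j C(N,j) (1)_{j,λ} S_{2,λ}(N-j,m) = S_{2,λ}(N,m) + (m+1) S_{2,λ}(N,m+1).
-- This recurrence compares two expansions of (1+x)_{N,λ} in the falling factorials (x)_k, one by
-- Vandermonde's identity and one by (1+x)_{k+1} = (x)_{k+1} + (k+1)(x)_k; such coefficients are
-- unique because (k)_i vanishes exactly when i > k. The m-th coefficient of Li_{p,λ}(u)/u is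
-- (-1)^m/m! times the weight λ^m (1)_{m+1,1/λ}/(m+1)^p, so composing with y cancels m! and one
-- sign, and the binomial convolution with e_λ^x(-t) gives the first formula at -x. The second
-- formula compares the coefficients of (x+r)_{n,λ} = Σ_j C(n,j) (x)_{j,λ} (r)_{n-j,λ} expanded
-- through S_{2,λ} with those given by S^{(r)}_{2,λ}.
module Submission where

open import Defs
open import Data.Nat as ℕ using (ℕ; zero; suc; _∸_; _!; s≤s)
import Data.Nat.Properties as ℕP
open import Data.Nat.Combinatorics using (_C_; k![n∸k]!∣n!; nCk+nC[k+1]≡[n+1]C[k+1]; k>n⇒nCk≡0)
open import Data.Nat.Combinatorics.Specification using (nCk≡n!/k![n-k]!)
open import Data.Nat.DivMod using (m/n*n≡m)
open import Data.Nat.Induction using (<-rec)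
open import Data.Integer as ℤ using (ℤ; -[1+_])
import Data.Integer.Tactic.RingSolver as ℤ-Solver
open import Data.Rational using (ℚ; 0ℚ; 1ℚ; _+_; _*_; _-_; -_; _/_; 1/_; NonZero; toℚᵘ; ≢-nonZero)
import Data.Rational.Properties as ℚP
import Data.Rational.Unnormalised as ℚᵘ
import Data.Rational.Unnormalised.Properties as ℚᵘP
open import Data.Product using (_×_; _,_)
open import Data.Sum using (inj₁; inj₂)
open import Level using (0ℓ)
open import Relation.Binary.PropositionalEquality
open import Relation.Nullary.Decidable using (dec⇒maybe)
open import Tactic.RingSolver using (solve-∀)
open import Tactic.RingSolver.Core.AlmostCommutativeRing using (AlmostCommutativeRing; fromCommutativeRing)

ℚ-ring : AlmostCommutativeRing 0ℓ 0ℓ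
ℚ-ring = fromCommutativeRing ℚP.+-*-commutativeRing (λ x → dec⇒maybe (0ℚ ℚP.≟ x))

toℚᵘ-ℕ→ℚ : ∀ n → toℚᵘ (ℕ→ℚ n) ℚᵘ.≃ ℚᵘ.mkℚᵘ (ℤ.+ n) 0
toℚᵘ-ℕ→ℚ n = ℚP.toℚᵘ-fromℚᵘ (ℚᵘ.mkℚᵘ (ℤ.+ n) 0)

ℕ→ℚ-suc : ∀ n → ℕ→ℚ (suc n) ≡ 1ℚ + ℕ→ℚ n
ℕ→ℚ-suc n = ℚP.toℚᵘ-injective (begin
  toℚᵘ (ℕ→ℚ (suc n))                ≈⟨ toℚᵘ-ℕ→ℚ (suc n) ⟩
  ℚᵘ.mkℚᵘ (ℤ.+ suc n) 0              ≈⟨ ℚᵘ.*≡* (cross-multiplied (ℤ.+ n)) ⟩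
  ℚᵘ.1ℚᵘ ℚᵘ.+ ℚᵘ.mkℚᵘ (ℤ.+ n) 0      ≈⟨ ℚᵘP.+-congʳ ℚᵘ.1ℚᵘ (toℚᵘ-ℕ→ℚ n) ⟨
  toℚᵘ 1ℚ ℚᵘ.+ toℚᵘ (ℕ→ℚ n)          ≈⟨ ℚP.toℚᵘ-homo-+ 1ℚ (ℕ→ℚ n) ⟨
  toℚᵘ (1ℚ + ℕ→ℚ n)                  ∎)
  where
  open ℚᵘP.≃-Reasoning
  cross-multiplied : ∀ m → (ℤ.1ℤ ℤ.+ m) ℤ.* ℤ.1ℤ ≡ (ℤ.1ℤ ℤ.* ℤ.1ℤ ℤ.+ m ℤ.* ℤ.1ℤ) ℤ.* ℤ.1ℤ
  cross-multiplied = solve-∀ ℤ-Solver.ring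

inv!-inverseˡ : ∀ k → inv! k * ℕ→ℚ (k !) ≡ 1ℚ
inv!-inverseˡ k = 1/d*d≡1 (k !) {{k ℕP.!≢0}}
  where
  1/d*d≡1 : ∀ d .{{_ : ℕ.NonZero d}} → (ℤ.1ℤ / d) * ℕ→ℚ d ≡ 1ℚ
  1/d*d≡1 (suc d) = ℚP.toℚᵘ-injective (begin
    toℚᵘ (ℤ.1ℤ / suc d * ℕ→ℚ (suc d))
      ≈⟨ ℚP.toℚᵘ-homo-* (ℤ.1ℤ / suc d) (ℕ→ℚ (suc d)) ⟩
    toℚᵘ (ℤ.1ℤ / suc d) ℚᵘ.* toℚᵘ (ℕ→ℚ (suc d))
      ≈⟨ ℚᵘP.*-cong (ℚP.toℚᵘ-fromℚᵘ (ℚᵘ.mkℚᵘ ℤ.1ℤ d)) (toℚᵘ-ℕ→ℚ (suc d)) ⟩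
    ℚᵘ.mkℚᵘ ℤ.1ℤ d ℚᵘ.* ℚᵘ.mkℚᵘ (ℤ.+ suc d) 0
      ≈⟨ ℚᵘ.*≡* (cross-multiplied (ℤ.+ d)) ⟩
    ℚᵘ.1ℚᵘ
      ∎)
    where
    open ℚᵘP.≃-Reasoning
    cross-multiplied : ∀ m → (ℤ.1ℤ ℤ.* (ℤ.1ℤ ℤ.+ m)) ℤ.* ℤ.1ℤ ≡ ℤ.1ℤ ℤ.* ((ℤ.1ℤ ℤ.+ m) ℤ.* ℤ.1ℤ)
    cross-multiplied = solve-∀ ℤ-Solver.ring

open ≡-Reasoning

ℕ→ℚ-+ : ∀ m n → ℕ→ℚ (m ℕ.+ n) ≡ ℕ→ℚ m + ℕ→ℚ n
ℕ→ℚ-+ zero    n = sym (ℚP.+-identityˡ (ℕ→ℚ n))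
ℕ→ℚ-+ (suc m) n = begin
  ℕ→ℚ (suc (m ℕ.+ n))      ≡⟨ ℕ→ℚ-suc (m ℕ.+ n) ⟩
  1ℚ + ℕ→ℚ (m ℕ.+ n)       ≡⟨ cong (1ℚ +_) (ℕ→ℚ-+ m n) ⟩
  1ℚ + (ℕ→ℚ m + ℕ→ℚ n)     ≡⟨ ℚP.+-assoc 1ℚ (ℕ→ℚ m) (ℕ→ℚ n) ⟨
  1ℚ + ℕ→ℚ m + ℕ→ℚ n       ≡⟨ cong (_+ ℕ→ℚ n) (ℕ→ℚ-suc m) ⟨
  ℕ→ℚ (suc m) + ℕ→ℚ n      ∎

ℕ→ℚ-* : ∀ m n → ℕ→ℚ (m ℕ.* n) ≡ ℕ→ℚ m * ℕ→ℚ n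
ℕ→ℚ-* zero    n = sym (ℚP.*-zeroˡ (ℕ→ℚ n))
ℕ→ℚ-* (suc m) n = begin
  ℕ→ℚ (n ℕ.+ m ℕ.* n)       ≡⟨ ℕ→ℚ-+ n (m ℕ.* n) ⟩
  ℕ→ℚ n + ℕ→ℚ (m ℕ.* n)     ≡⟨ cong (ℕ→ℚ n +_) (ℕ→ℚ-* m n) ⟩
  ℕ→ℚ n + ℕ→ℚ m * ℕ→ℚ n     ≡⟨ distrib (ℕ→ℚ m) (ℕ→ℚ n) ⟩
  (1ℚ + ℕ→ℚ m) * ℕ→ℚ n      ≡⟨ cong (_* ℕ→ℚ n) (ℕ→ℚ-suc m) ⟨
  ℕ→ℚ (suc m) * ℕ→ℚ n       ∎
  where
  distrib : ∀ a b → b + a * b ≡ (1ℚ + a) * b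
  distrib = solve-∀ ℚ-ring

ℕ→ℚ-suc≢0 : ∀ n → ℕ→ℚ (suc n) ≢ 0ℚ
ℕ→ℚ-suc≢0 n eq with ℚᵘP.≃-trans (ℚᵘP.≃-sym (toℚᵘ-ℕ→ℚ (suc n))) (ℚP.toℚᵘ-cong eq)
... | ℚᵘ.*≡* ()

k<n⇒n-k≢0 : ∀ {k n} → k ℕ.< n → ℕ→ℚ n - ℕ→ℚ k ≢ 0ℚ
k<n⇒n-k≢0 {k} k<n with ℕP.m≤n⇒∃[o]m+o≡n k<n
... | d , refl = λ n-k≡0 → ℕ→ℚ-suc≢0 d (begin
  ℕ→ℚ (suc d)                        ≡⟨ ℕ→ℚ-suc d ⟩
  1ℚ + ℕ→ℚ d                         ≡⟨ cancel (ℕ→ℚ k) (ℕ→ℚ d) ⟨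
  1ℚ + (ℕ→ℚ k + ℕ→ℚ d) - ℕ→ℚ k       ≡⟨ cong (λ z → 1ℚ + z - ℕ→ℚ k) (ℕ→ℚ-+ k d) ⟨
  1ℚ + ℕ→ℚ (k ℕ.+ d) - ℕ→ℚ k         ≡⟨ cong (_- ℕ→ℚ k) (ℕ→ℚ-suc (k ℕ.+ d)) ⟨
  ℕ→ℚ (suc (k ℕ.+ d)) - ℕ→ℚ k        ≡⟨ n-k≡0 ⟩
  0ℚ                                 ∎)
  where
  cancel : ∀ a b → 1ℚ + (a + b) - a ≡ 1ℚ + b
  cancel = solve-∀ ℚ-ring

*-zero-cancelʳ : ∀ {a b} → b ≢ 0ℚ → a * b ≡ 0ℚ → a ≡ 0ℚ
*-zero-cancelʳ {a} {b} b≢0 ab≡0 = begin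
  a                ≡⟨ ℚP.*-identityʳ a ⟨
  a * 1ℚ           ≡⟨ cong (a *_) (ℚP.*-inverseʳ b) ⟨
  a * (b * 1/ b)   ≡⟨ ℚP.*-assoc a b (1/ b) ⟨
  a * b * 1/ b     ≡⟨ cong (_* 1/ b) ab≡0 ⟩
  0ℚ * 1/ b        ≡⟨ ℚP.*-zeroˡ (1/ b) ⟩
  0ℚ               ∎
  where instance _ = ≢-nonZero b≢0

*-≢0 : ∀ {a b} → a ≢ 0ℚ → b ≢ 0ℚ → a * b ≢ 0ℚ
*-≢0 a≢0 b≢0 ab≡0 = a≢0 (*-zero-cancelʳ b≢0 ab≡0)

^ℕ-+ : ∀ x m n → x ^ℕ (m ℕ.+ n) ≡ x ^ℕ m * x ^ℕ n
^ℕ-+ x zero    n = sym (ℚP.*-identityˡ (x ^ℕ n))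
^ℕ-+ x (suc m) n = trans (cong (x *_) (^ℕ-+ x m n)) (sym (ℚP.*-assoc x (x ^ℕ m) (x ^ℕ n)))

sgn : ℕ → ℚ
sgn n = (- 1ℚ) ^ℕ n

sgn-∸ : ∀ {j n} → j ℕ.≤ n → sgn j * sgn (n ∸ j) ≡ sgn n
sgn-∸ {j} {n} j≤n = trans (sym (^ℕ-+ (- 1ℚ) j (n ∸ j))) (cong sgn (ℕP.m+[n∸m]≡n j≤n))

sgn*sgn : ∀ n → sgn n * sgn n ≡ 1ℚ
sgn*sgn zero    = refl
sgn*sgn (suc n) = trans (square-neg (sgn n)) (sgn*sgn n)
  where
  square-neg : ∀ s → (- 1ℚ) * s * ((- 1ℚ) * s) ≡ s * s
  square-neg = solve-∀ ℚ-ring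

-^ℕ : ∀ x n → (- x) ^ℕ n ≡ sgn n * x ^ℕ n
-^ℕ x zero    = refl
-^ℕ x (suc n) = trans (cong (- x *_) (-^ℕ x n)) (pull-sign x (sgn n) (x ^ℕ n))
  where
  pull-sign : ∀ x s y → - x * (s * y) ≡ (- 1ℚ) * s * (x * y)
  pull-sign = solve-∀ ℚ-ring

Σ≤-cong : ∀ n {f g : ℕ → ℚ} → (∀ k → k ℕ.≤ n → f k ≡ g k) → Σ≤ n f ≡ Σ≤ n g
Σ≤-cong zero    f≡g = f≡g 0 ℕ.z≤n
Σ≤-cong (suc n) f≡g = cong₂ _+_ (Σ≤-cong n (λ k k≤n → f≡g k (ℕP.m≤n⇒m≤1+n k≤n))) (f≡g (suc n) ℕP.≤-refl)

Σ≤-zero : ∀ n {f : ℕ → ℚ} → (∀ k → k ℕ.≤ n → f k ≡ 0ℚ) → Σ≤ n f ≡ 0ℚ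
Σ≤-zero zero    f≡0 = f≡0 0 ℕ.z≤n
Σ≤-zero (suc n) f≡0 = cong₂ _+_ (Σ≤-zero n (λ k k≤n → f≡0 k (ℕP.m≤n⇒m≤1+n k≤n))) (f≡0 (suc n) ℕP.≤-refl)

Σ≤-+ : ∀ n (f g : ℕ → ℚ) → Σ≤ n (λ k → f k + g k) ≡ Σ≤ n f + Σ≤ n g
Σ≤-+ zero    f g = refl
Σ≤-+ (suc n) f g = trans (cong (_+ (f (suc n) + g (suc n))) (Σ≤-+ n f g))
                     (interchange (Σ≤ n f) (Σ≤ n g) (f (suc n)) (g (suc n)))
  where
  interchange : ∀ a b c d → a + b + (c + d) ≡ a + c + (b + d)
  interchange = solve-∀ ℚ-ring

Σ≤-- : ∀ n (f g : ℕ → ℚ) → Σ≤ n (λ k → f k - g k) ≡ Σ≤ n f - Σ≤ n g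
Σ≤-- zero    f g = refl
Σ≤-- (suc n) f g = trans (cong (_+ (f (suc n) - g (suc n))) (Σ≤-- n f g))
                     (interchange (Σ≤ n f) (Σ≤ n g) (f (suc n)) (g (suc n)))
  where
  interchange : ∀ a b c d → a - b + (c - d) ≡ a + c - (b + d)
  interchange = solve-∀ ℚ-ring

*-Σ≤ : ∀ n c (f : ℕ → ℚ) → c * Σ≤ n f ≡ Σ≤ n (λ k → c * f k)
*-Σ≤ zero    c f = refl
*-Σ≤ (suc n) c f = trans (ℚP.*-distribˡ-+ c (Σ≤ n f) (f (suc n))) (cong (_+ c * f (suc n)) (*-Σ≤ n c f))

Σ≤-* : ∀ n c (f : ℕ → ℚ) → Σ≤ n f * c ≡ Σ≤ n (λ k → f k * c)
Σ≤-* n c f = trans (ℚP.*-comm (Σ≤ n f) c) (trans (*-Σ≤ n c f) (Σ≤-cong n (λ k _ → ℚP.*-comm c (f k))))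

Σ≤-swap : ∀ m n (f : ℕ → ℕ → ℚ) → Σ≤ m (λ i → Σ≤ n (f i)) ≡ Σ≤ n (λ j → Σ≤ m (λ i → f i j))
Σ≤-swap zero    n f = refl
Σ≤-swap (suc m) n f = begin
  Σ≤ m (λ i → Σ≤ n (f i)) + Σ≤ n (f (suc m))            ≡⟨ cong (_+ Σ≤ n (f (suc m))) (Σ≤-swap m n f) ⟩
  Σ≤ n (λ j → Σ≤ m (λ i → f i j)) + Σ≤ n (f (suc m))    ≡⟨ Σ≤-+ n _ _ ⟨
  Σ≤ n (λ j → Σ≤ m (λ i → f i j) + f (suc m) j)         ∎

Σ≤-suc : ∀ n (f : ℕ → ℚ) → Σ≤ (suc n) f ≡ f 0 + Σ≤ n (λ k → f (suc k))
Σ≤-suc zero    f = refl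
Σ≤-suc (suc n) f = trans (cong (_+ f (suc (suc n))) (Σ≤-suc n f)) (ℚP.+-assoc (f 0) _ _)

Σ≤-extend : ∀ {m n} (f : ℕ → ℚ) → m ℕ.≤ n → (∀ k → m ℕ.< k → k ℕ.≤ n → f k ≡ 0ℚ) → Σ≤ n f ≡ Σ≤ m f
Σ≤-extend {m} f m≤n = go (ℕP.≤⇒≤′ m≤n)
  where
  go : ∀ {n} → m ℕ.≤′ n → (∀ k → m ℕ.< k → k ℕ.≤ n → f k ≡ 0ℚ) → Σ≤ n f ≡ Σ≤ m f
  go ℕ.≤′-refl              _   = refl
  go (ℕ.≤′-step {n} m≤′n) f≡0 = begin
    Σ≤ n f + f (suc n)   ≡⟨ cong₂ _+_ (go m≤′n (λ k m<k k≤n → f≡0 k m<k (ℕP.m≤n⇒m≤1+n k≤n)))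
                                      (f≡0 (suc n) (s≤s (ℕP.≤′⇒≤ m≤′n)) ℕP.≤-refl) ⟩
    Σ≤ m f + 0ℚ          ≡⟨ ℚP.+-identityʳ (Σ≤ m f) ⟩
    Σ≤ m f               ∎

Σ≤-last : ∀ n (f : ℕ → ℚ) → (∀ k → k ℕ.< n → f k ≡ 0ℚ) → Σ≤ n f ≡ f n
Σ≤-last zero    f _   = refl
Σ≤-last (suc n) f f≡0 = trans (cong (_+ f (suc n)) (Σ≤-zero n (λ k k≤n → f≡0 k (s≤s k≤n))))
                              (ℚP.+-identityˡ (f (suc n)))

Σ≤-*one : ∀ n (f : ℕ → ℚ) → Σ≤ n (λ k → f k * one k) ≡ f 0
Σ≤-*one zero    f = ℚP.*-identityʳ (f 0)
Σ≤-*one (suc n) f = begin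
  Σ≤ n (λ k → f k * one k) + f (suc n) * 0ℚ   ≡⟨ cong₂ _+_ (Σ≤-*one n f) (ℚP.*-zeroʳ (f (suc n))) ⟩
  f 0 + 0ℚ                                   ≡⟨ ℚP.+-identityʳ (f 0) ⟩
  f 0                                        ∎

fall-0 : ∀ μ n → fall μ 0ℚ n ≡ one n
fall-0 μ zero          = refl
fall-0 μ (suc zero)    = first-factor μ
  where
  first-factor : ∀ μ → 1ℚ * (0ℚ - 0ℚ * μ) ≡ 0ℚ
  first-factor = solve-∀ ℚ-ring
fall-0 μ (suc (suc n)) = trans (cong (_* (0ℚ - ℕ→ℚ (suc n) * μ)) (fall-0 μ (suc n)))
                               (ℚP.*-zeroˡ (0ℚ - ℕ→ℚ (suc n) * μ))

fall-ℕ-vanish : ∀ {k i} → k ℕ.< i → fall 1ℚ (ℕ→ℚ k) i ≡ 0ℚ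
fall-ℕ-vanish {k} k<i = go (ℕP.<⇒<′ k<i)
  where
  vanishing-factor : ∀ a x → a * (x - x * 1ℚ) ≡ 0ℚ
  vanishing-factor = solve-∀ ℚ-ring
  go : ∀ {i} → k ℕ.<′ i → fall 1ℚ (ℕ→ℚ k) i ≡ 0ℚ
  go ℕ.<′-base            = vanishing-factor (fall 1ℚ (ℕ→ℚ k) k) (ℕ→ℚ k)
  go (ℕ.<′-step {i} k<′i) = trans (cong (_* (ℕ→ℚ k - ℕ→ℚ i * 1ℚ)) (go k<′i))
                                  (ℚP.*-zeroˡ (ℕ→ℚ k - ℕ→ℚ i * 1ℚ))

fall-ℕ-≢0 : ∀ {i k} → i ℕ.≤ k → fall 1ℚ (ℕ→ℚ k) i ≢ 0ℚ
fall-ℕ-≢0 {zero}      _   = ℚP.1≢0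
fall-ℕ-≢0 {suc i} {k} i<k = *-≢0 (fall-ℕ-≢0 (ℕP.<⇒≤ i<k)) factor≢0
  where
  factor≢0 : ℕ→ℚ k - ℕ→ℚ i * 1ℚ ≢ 0ℚ
  factor≢0 = subst (λ z → ℕ→ℚ k - z ≢ 0ℚ) (sym (ℚP.*-identityʳ (ℕ→ℚ i))) (k<n⇒n-k≢0 i<k)

-- Evaluating at x = k, the terms with i > k vanish and (k)_k ≠ 0; this determines c k from c 0, …, c (k - 1).
fall-coeffs-zero : ∀ N (c : ℕ → ℚ) → (∀ x → Σ≤ N (λ i → c i * fall 1ℚ (ℕ→ℚ x) i) ≡ 0ℚ) →
                   ∀ k → k ℕ.≤ N → c k ≡ 0ℚ
fall-coeffs-zero N c sum≡0 = <-rec (λ k → k ℕ.≤ N → c k ≡ 0ℚ) step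
  where
  step : ∀ k → (∀ {i} → i ℕ.< k → i ℕ.≤ N → c i ≡ 0ℚ) → k ℕ.≤ N → c k ≡ 0ℚ
  step k c<k≡0 k≤N = *-zero-cancelʳ (fall-ℕ-≢0 {k} ℕP.≤-refl) (begin
    c k * ff k                ≡⟨ Σ≤-last k (λ i → c i * ff i) lower≡0 ⟨
    Σ≤ k (λ i → c i * ff i)   ≡⟨ Σ≤-extend _ k≤N upper≡0 ⟨
    Σ≤ N (λ i → c i * ff i)   ≡⟨ sum≡0 k ⟩
    0ℚ                        ∎)
    where
    ff : ℕ → ℚ
    ff = fall 1ℚ (ℕ→ℚ k)
    lower≡0 : ∀ i → i ℕ.< k → c i * ff i ≡ 0ℚ
    lower≡0 i i<k = trans (cong (_* ff i) (c<k≡0 i<k (ℕP.<⇒≤ (ℕP.<-≤-trans i<k k≤N)))) (ℚP.*-zeroˡ (ff i))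
    upper≡0 : ∀ i → k ℕ.< i → i ℕ.≤ N → c i * ff i ≡ 0ℚ
    upper≡0 i k<i _ = trans (cong (c i *_) (fall-ℕ-vanish k<i)) (ℚP.*-zeroʳ (c i))

fall-coeffs-injective : ∀ N (a b : ℕ → ℚ) →
  (∀ x → Σ≤ N (λ i → a i * fall 1ℚ (ℕ→ℚ x) i) ≡ Σ≤ N (λ i → b i * fall 1ℚ (ℕ→ℚ x) i)) →
  ∀ k → k ℕ.≤ N → a k ≡ b k
fall-coeffs-injective N a b same k k≤N = begin
  a k              ≡⟨ sub-add (a k) (b k) ⟩
  a k - b k + b k  ≡⟨ cong (_+ b k) (fall-coeffs-zero N (λ i → a i - b i) difference≡0 k k≤N) ⟩
  0ℚ + b k         ≡⟨ ℚP.+-identityˡ (b k) ⟩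
  b k              ∎
  where
  sub-add : ∀ a b → a ≡ a - b + b
  sub-add = solve-∀ ℚ-ring
  *-distribʳ-- : ∀ a b c → (a - b) * c ≡ a * c - b * c
  *-distribʳ-- = solve-∀ ℚ-ring
  difference≡0 : ∀ x → Σ≤ N (λ i → (a i - b i) * fall 1ℚ (ℕ→ℚ x) i) ≡ 0ℚ
  difference≡0 x = begin
    Σ≤ N (λ i → (a i - b i) * ff i)      ≡⟨ Σ≤-cong N (λ i _ → *-distribʳ-- (a i) (b i) (ff i)) ⟩
    Σ≤ N (λ i → a i * ff i - b i * ff i) ≡⟨ Σ≤-- N _ _ ⟩
    Σ≤ N (λ i → a i * ff i) - B          ≡⟨ cong (_- B) (same x) ⟩
    B - B                                ≡⟨ ℚP.+-inverseʳ B ⟩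
    0ℚ                                   ∎
    where
    ff : ℕ → ℚ
    ff = fall 1ℚ (ℕ→ℚ x)
    B : ℚ
    B = Σ≤ N (λ i → b i * ff i)

fall-1+x : ∀ x k → fall 1ℚ (1ℚ + x) (suc k) ≡ (1ℚ + x) * fall 1ℚ x k
fall-1+x x zero    = first-factor x
  where
  first-factor : ∀ x → 1ℚ * (1ℚ + x - 0ℚ * 1ℚ) ≡ (1ℚ + x) * 1ℚ
  first-factor = solve-∀ ℚ-ring
fall-1+x x (suc k) = begin
  fall 1ℚ (1ℚ + x) (suc k) * (1ℚ + x - ℕ→ℚ (suc k) * 1ℚ)
    ≡⟨ cong₂ (λ a n → a * (1ℚ + x - n * 1ℚ)) (fall-1+x x k) (ℕ→ℚ-suc k) ⟩
  (1ℚ + x) * fall 1ℚ x k * (1ℚ + x - (1ℚ + ℕ→ℚ k) * 1ℚ)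
    ≡⟨ shift x (fall 1ℚ x k) (ℕ→ℚ k) ⟩
  (1ℚ + x) * (fall 1ℚ x k * (x - ℕ→ℚ k * 1ℚ))
    ∎
  where
  shift : ∀ x a n → (1ℚ + x) * a * (1ℚ + x - (1ℚ + n) * 1ℚ) ≡ (1ℚ + x) * (a * (x - n * 1ℚ))
  shift = solve-∀ ℚ-ring

fall-1+x-expand : ∀ x k → fall 1ℚ (1ℚ + x) (suc k) ≡ fall 1ℚ x (suc k) + ℕ→ℚ (suc k) * fall 1ℚ x k
fall-1+x-expand x k = begin
  fall 1ℚ (1ℚ + x) (suc k)
    ≡⟨ fall-1+x x k ⟩
  (1ℚ + x) * fall 1ℚ x k
    ≡⟨ split x (fall 1ℚ x k) (ℕ→ℚ k) ⟩
  fall 1ℚ x k * (x - ℕ→ℚ k * 1ℚ) + (1ℚ + ℕ→ℚ k) * fall 1ℚ x k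
    ≡⟨ cong (λ n → fall 1ℚ x (suc k) + n * fall 1ℚ x k) (ℕ→ℚ-suc k) ⟨
  fall 1ℚ x (suc k) + ℕ→ℚ (suc k) * fall 1ℚ x k
    ∎
  where
  split : ∀ x a n → (1ℚ + x) * a ≡ a * (x - n * 1ℚ) + (1ℚ + n) * a
  split = solve-∀ ℚ-ring

Σ≤-fall-1+x : ∀ N (s : ℕ → ℚ) → s (suc N) ≡ 0ℚ → ∀ x →
  Σ≤ N (λ k → s k * fall 1ℚ (1ℚ + x) k) ≡ Σ≤ N (λ k → (s k + ℕ→ℚ (suc k) * s (suc k)) * fall 1ℚ x k)
Σ≤-fall-1+x N s s[1+N]≡0 x = begin
  Σ≤ N (λ k → s k * G k)
    ≡⟨ Σ≤-extend _ (ℕP.n≤1+n N) (top≡0 G) ⟨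
  Σ≤ (suc N) (λ k → s k * G k)
    ≡⟨ Σ≤-suc N _ ⟩
  s 0 * 1ℚ + Σ≤ N (λ k → s (suc k) * G (suc k))
    ≡⟨ cong (s 0 * 1ℚ +_) (Σ≤-cong N (λ k _ → cong (s (suc k) *_) (fall-1+x-expand x k))) ⟩
  s 0 * 1ℚ + Σ≤ N (λ k → s (suc k) * (F (suc k) + ℕ→ℚ (suc k) * F k))
    ≡⟨ cong (s 0 * 1ℚ +_) (trans (Σ≤-cong N (λ k _ → ℚP.*-distribˡ-+ (s (suc k)) _ _)) (Σ≤-+ N _ _)) ⟩
  s 0 * 1ℚ + (Σ≤ N (λ k → s (suc k) * F (suc k)) + D)
    ≡⟨ ℚP.+-assoc (s 0 * 1ℚ) _ D ⟨
  s 0 * 1ℚ + Σ≤ N (λ k → s (suc k) * F (suc k)) + D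
    ≡⟨ cong (_+ D) (Σ≤-suc N (λ k → s k * F k)) ⟨
  Σ≤ (suc N) (λ k → s k * F k) + D
    ≡⟨ cong (_+ D) (Σ≤-extend _ (ℕP.n≤1+n N) (top≡0 F)) ⟩
  Σ≤ N (λ k → s k * F k) + D
    ≡⟨ Σ≤-+ N _ _ ⟨
  Σ≤ N (λ k → s k * F k + s (suc k) * (ℕ→ℚ (suc k) * F k))
    ≡⟨ Σ≤-cong N (λ k _ → collect (s k) (s (suc k)) (ℕ→ℚ (suc k)) (F k)) ⟩
  Σ≤ N (λ k → (s k + ℕ→ℚ (suc k) * s (suc k)) * F k)
    ∎
  where
  F G : ℕ → ℚ
  F = fall 1ℚ x
  G = fall 1ℚ (1ℚ + x)
  D : ℚ
  D = Σ≤ N (λ k → s (suc k) * (ℕ→ℚ (suc k) * F k))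
  top≡0 : ∀ (H : ℕ → ℚ) k → N ℕ.< k → k ℕ.≤ suc N → s k * H k ≡ 0ℚ
  top≡0 H k N<k k≤1+N rewrite ℕP.≤-antisym k≤1+N N<k = trans (cong (_* H (suc N)) s[1+N]≡0) (ℚP.*-zeroˡ (H (suc N)))
  collect : ∀ a b n c → a * c + b * (n * c) ≡ (a + n * b) * c
  collect = solve-∀ ℚ-ring

Σ≤-pascal : ∀ N (f : ℕ → ℕ → ℚ) →
  Σ≤ N (λ j → binom N j * (f (suc j) (N ∸ j) + f j (suc N ∸ j)))
    ≡ Σ≤ (suc N) (λ j → binom (suc N) j * f j (suc N ∸ j))
Σ≤-pascal N f = begin
  Σ≤ N (λ j → binom N j * (f (suc j) (N ∸ j) + f j (suc N ∸ j)))
    ≡⟨ trans (Σ≤-cong N (λ j _ → ℚP.*-distribˡ-+ (binom N j) _ _)) (Σ≤-+ N _ _) ⟩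
  A + Σ≤ N (λ j → binom N j * f j (suc N ∸ j))
    ≡⟨ cong (A +_) (Σ≤-extend _ (ℕP.n≤1+n N) binom-top≡0) ⟨
  A + Σ≤ (suc N) (λ j → binom N j * f j (suc N ∸ j))
    ≡⟨ cong (A +_) (Σ≤-suc N _) ⟩
  A + (f₀ + B)
    ≡⟨ swap-front A f₀ B ⟩
  f₀ + (A + B)
    ≡⟨ cong (f₀ +_) (Σ≤-+ N _ _) ⟨
  f₀ + Σ≤ N (λ j → binom N j * f (suc j) (N ∸ j) + binom N (suc j) * f (suc j) (N ∸ j))
    ≡⟨ cong (f₀ +_) (Σ≤-cong N (λ j _ → pascal j)) ⟩
  f₀ + Σ≤ N (λ j → binom (suc N) (suc j) * f (suc j) (N ∸ j))
    ≡⟨ Σ≤-suc N _ ⟨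
  Σ≤ (suc N) (λ j → binom (suc N) j * f j (suc N ∸ j))
    ∎
  where
  A B f₀ : ℚ
  A  = Σ≤ N (λ j → binom N j * f (suc j) (N ∸ j))
  B  = Σ≤ N (λ j → binom N (suc j) * f (suc j) (N ∸ j))
  f₀ = binom (suc N) 0 * f 0 (suc N)
  swap-front : ∀ a b c → a + (b + c) ≡ b + (a + c)
  swap-front = solve-∀ ℚ-ring
  binom-top≡0 : ∀ j → N ℕ.< j → j ℕ.≤ suc N → binom N j * f j (suc N ∸ j) ≡ 0ℚ
  binom-top≡0 j N<j _ = trans (cong (λ c → ℕ→ℚ c * f j (suc N ∸ j)) (k>n⇒nCk≡0 N<j)) (ℚP.*-zeroˡ (f j (suc N ∸ j)))
  pascal : ∀ j → binom N j * f (suc j) (N ∸ j) + binom N (suc j) * f (suc j) (N ∸ j)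
               ≡ binom (suc N) (suc j) * f (suc j) (N ∸ j)
  pascal j = begin
    binom N j * t + binom N (suc j) * t    ≡⟨ ℚP.*-distribʳ-+ t (binom N j) (binom N (suc j)) ⟨
    (binom N j + binom N (suc j)) * t      ≡⟨ cong (_* t) (ℕ→ℚ-+ (N C j) (N C suc j)) ⟨
    ℕ→ℚ (N C j ℕ.+ N C suc j) * t          ≡⟨ cong (λ c → ℕ→ℚ c * t) (nCk+nC[k+1]≡[n+1]C[k+1] N j) ⟩
    binom (suc N) (suc j) * t              ∎
    where
    t : ℚ
    t = f (suc j) (N ∸ j)

fall-vandermonde : ∀ μ x y N → fall μ (x + y) N ≡ Σ≤ N (λ j → binom N j * fall μ x j * fall μ y (N ∸ j))
fall-vandermonde μ x y zero    = refl
fall-vandermonde μ x y (suc N) = begin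
  fall μ (x + y) N * (x + y - ℕ→ℚ N * μ)
    ≡⟨ cong (_* (x + y - ℕ→ℚ N * μ)) (fall-vandermonde μ x y N) ⟩
  Σ≤ N (λ j → binom N j * fall μ x j * fall μ y (N ∸ j)) * (x + y - ℕ→ℚ N * μ)
    ≡⟨ Σ≤-* N _ _ ⟩
  Σ≤ N (λ j → binom N j * fall μ x j * fall μ y (N ∸ j) * (x + y - ℕ→ℚ N * μ))
    ≡⟨ Σ≤-cong N split ⟩
  Σ≤ N (λ j → binom N j * (F (suc j) (N ∸ j) + F j (suc N ∸ j)))
    ≡⟨ Σ≤-pascal N F ⟩
  Σ≤ (suc N) (λ j → binom (suc N) j * F j (suc N ∸ j))
    ≡⟨ Σ≤-cong (suc N) (λ j _ → sym (ℚP.*-assoc (binom (suc N) j) _ _)) ⟩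
  Σ≤ (suc N) (λ j → binom (suc N) j * fall μ x j * fall μ y (suc N ∸ j))
    ∎
  where
  F : ℕ → ℕ → ℚ
  F i k = fall μ x i * fall μ y k
  distribute : ∀ x y μ c a b i k → c * a * b * (x + y - (i + k) * μ) ≡ c * (a * (x - i * μ) * b + a * (b * (y - k * μ)))
  distribute = solve-∀ ℚ-ring
  split : ∀ j → j ℕ.≤ N → binom N j * fall μ x j * fall μ y (N ∸ j) * (x + y - ℕ→ℚ N * μ)
                        ≡ binom N j * (F (suc j) (N ∸ j) + F j (suc N ∸ j))
  split j j≤N = begin
    c * a * b * (x + y - ℕ→ℚ N * μ)
      ≡⟨ cong (λ n → c * a * b * (x + y - ℕ→ℚ n * μ)) (ℕP.m+[n∸m]≡n j≤N) ⟨
    c * a * b * (x + y - ℕ→ℚ (j ℕ.+ (N ∸ j)) * μ)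
      ≡⟨ cong (λ n → c * a * b * (x + y - n * μ)) (ℕ→ℚ-+ j (N ∸ j)) ⟩
    c * a * b * (x + y - (ℕ→ℚ j + ℕ→ℚ (N ∸ j)) * μ)
      ≡⟨ distribute x y μ c a b (ℕ→ℚ j) (ℕ→ℚ (N ∸ j)) ⟩
    c * (F (suc j) (N ∸ j) + a * fall μ y (suc (N ∸ j)))
      ≡⟨ cong (λ n → c * (F (suc j) (N ∸ j) + a * fall μ y n)) (ℕP.+-∸-assoc 1 j≤N) ⟨
    c * (F (suc j) (N ∸ j) + F j (suc N ∸ j))
      ∎
    where
    c a b : ℚ
    c = binom N j
    a = fall μ x j
    b = fall μ y (N ∸ j)

ℕ→ℚ[n!]≡binom*k!*[n∸k]! : ∀ {k n} → k ℕ.≤ n → ℕ→ℚ (n !) ≡ binom n k * (ℕ→ℚ (k !) * ℕ→ℚ ((n ∸ k) !))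
ℕ→ℚ[n!]≡binom*k!*[n∸k]! {k} {n} k≤n = begin
  ℕ→ℚ (n !)                                   ≡⟨ cong ℕ→ℚ n!≡nCk*k!*[n∸k]! ⟨
  ℕ→ℚ ((n C k) ℕ.* (k ! ℕ.* (n ∸ k) !))       ≡⟨ ℕ→ℚ-* (n C k) _ ⟩
  binom n k * ℕ→ℚ (k ! ℕ.* (n ∸ k) !)         ≡⟨ cong (binom n k *_) (ℕ→ℚ-* (k !) ((n ∸ k) !)) ⟩
  binom n k * (ℕ→ℚ (k !) * ℕ→ℚ ((n ∸ k) !))   ∎
  where
  n!≡nCk*k!*[n∸k]! : (n C k) ℕ.* (k ! ℕ.* (n ∸ k) !) ≡ n !
  n!≡nCk*k!*[n∸k]! = trans (cong (ℕ._* (k ! ℕ.* (n ∸ k) !)) (nCk≡n!/k![n-k]! k≤n))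
                           (m/n*n≡m {{_}} (k![n∸k]!∣n! k≤n))

egfCoeff : Series → ℕ → ℚ
egfCoeff f n = ℕ→ℚ (n !) * f n

egfCoeff-⊛ : ∀ (f g : Series) n → egfCoeff (f ⊛ g) n ≡ Σ≤ n (λ j → binom n j * egfCoeff f j * egfCoeff g (n ∸ j))
egfCoeff-⊛ f g n = trans (*-Σ≤ n (ℕ→ℚ (n !)) _) (Σ≤-cong n term)
  where
  regroup : ∀ c a b u v → c * (a * b) * (u * v) ≡ c * (a * u) * (b * v)
  regroup = solve-∀ ℚ-ring
  term : ∀ j → j ℕ.≤ n → ℕ→ℚ (n !) * (f j * g (n ∸ j)) ≡ binom n j * egfCoeff f j * egfCoeff g (n ∸ j)
  term j j≤n = trans (cong (_* (f j * g (n ∸ j))) (ℕ→ℚ[n!]≡binom*k!*[n∸k]! j≤n))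
                     (regroup (binom n j) (ℕ→ℚ (j !)) (ℕ→ℚ ((n ∸ j) !)) (f j) (g (n ∸ j)))

egfCoeff-⊖ : ∀ (f g : Series) n → egfCoeff (f ⊖ g) n ≡ egfCoeff f n - egfCoeff g n
egfCoeff-⊖ f g n = distrib (ℕ→ℚ (n !)) (f n) (g n)
  where
  distrib : ∀ c a b → c * (a - b) ≡ c * a - c * b
  distrib = solve-∀ ℚ-ring

egfCoeff-one : ∀ n → egfCoeff one n ≡ one n
egfCoeff-one zero    = refl
egfCoeff-one (suc n) = ℚP.*-zeroʳ (ℕ→ℚ (suc n !))

egfCoeff-negT : ∀ (f : Series) n → egfCoeff (negT f) n ≡ sgn n * egfCoeff f n
egfCoeff-negT f n = swap (ℕ→ℚ (n !)) (sgn n) (f n)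
  where
  swap : ∀ a b c → a * (b * c) ≡ b * (a * c)
  swap = solve-∀ ℚ-ring

egfCoeff-eSeries : ∀ μ x n → egfCoeff (eSeries μ x) n ≡ fall μ x n
egfCoeff-eSeries μ x n = begin
  ℕ→ℚ (n !) * (fall μ x n * inv! n)  ≡⟨ regroup (ℕ→ℚ (n !)) (fall μ x n) (inv! n) ⟩
  fall μ x n * (inv! n * ℕ→ℚ (n !))  ≡⟨ cong (fall μ x n *_) (inv!-inverseˡ n) ⟩
  fall μ x n * 1ℚ                    ≡⟨ ℚP.*-identityʳ (fall μ x n) ⟩
  fall μ x n                         ∎
  where
  regroup : ∀ a b c → a * (b * c) ≡ b * (c * a)
  regroup = solve-∀ ℚ-ring

egfCoeff-negT-eSeries : ∀ μ x n → egfCoeff (negT (eSeries μ x)) n ≡ sgn n * fall μ x n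
egfCoeff-negT-eSeries μ x n = trans (egfCoeff-negT (eSeries μ x) n) (cong (sgn n *_) (egfCoeff-eSeries μ x n))

egfCoeff-ySeries : ∀ lam n → egfCoeff (ySeries lam) n ≡ one n - sgn n * fall lam 1ℚ n
egfCoeff-ySeries lam n = trans (egfCoeff-⊖ one (negT (eSeries lam 1ℚ)) n)
                               (cong₂ _-_ (egfCoeff-one n) (egfCoeff-negT-eSeries lam 1ℚ n))

egfCoeff-ySeries-⊛ : ∀ lam (g : Series) N →
  egfCoeff (ySeries lam ⊛ g) N ≡ egfCoeff g N - Σ≤ N (λ j → sgn j * (binom N j * fall lam 1ℚ j * egfCoeff g (N ∸ j)))
egfCoeff-ySeries-⊛ lam g N = begin
  egfCoeff (ySeries lam ⊛ g) N
    ≡⟨ egfCoeff-⊛ (ySeries lam) g N ⟩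
  Σ≤ N (λ j → binom N j * egfCoeff (ySeries lam) j * G (N ∸ j))
    ≡⟨ Σ≤-cong N (λ j _ → cong (λ e → binom N j * e * G (N ∸ j)) (egfCoeff-ySeries lam j)) ⟩
  Σ≤ N (λ j → binom N j * (one j - sgn j * fall lam 1ℚ j) * G (N ∸ j))
    ≡⟨ Σ≤-cong N (λ j _ → separate (binom N j) (one j) (sgn j) (fall lam 1ℚ j) (G (N ∸ j))) ⟩
  Σ≤ N (λ j → binom N j * G (N ∸ j) * one j - sgn j * (binom N j * fall lam 1ℚ j * G (N ∸ j)))
    ≡⟨ Σ≤-- N _ _ ⟩
  Σ≤ N (λ j → binom N j * G (N ∸ j) * one j) - Σ≤ N (λ j → sgn j * (binom N j * fall lam 1ℚ j * G (N ∸ j)))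
    ≡⟨ cong (_- Σ≤ N (λ j → sgn j * (binom N j * fall lam 1ℚ j * G (N ∸ j))))
            (trans (Σ≤-*one N (λ j → binom N j * G (N ∸ j))) (ℚP.*-identityˡ (G N))) ⟩
  G N - Σ≤ N (λ j → sgn j * (binom N j * fall lam 1ℚ j * G (N ∸ j)))
    ∎
  where
  G : ℕ → ℚ
  G = egfCoeff g
  separate : ∀ b o s f g → b * (o - s * f) * g ≡ b * g * o - s * (b * f * g)
  separate = solve-∀ ℚ-ring

liWeight : (lam : ℚ) → .{{NonZero lam}} → ℤ → ℕ → ℚ
liWeight lam p k = divPow (lam ^ℕ k * fall (1/ lam) 1ℚ (suc k)) k p

divPow-*ˡ : ∀ a c k p → divPow (a * c) k p ≡ a * divPow c k p
divPow-*ˡ a c k (ℤ.+ m)  = ℚP.*-assoc a c _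
divPow-*ˡ a c k -[1+ m ] = ℚP.*-assoc a c _

LiOverU-liWeight : ∀ lam .{{_ : NonZero lam}} p m → LiOverU lam p m ≡ sgn m * inv! m * liWeight lam p m
LiOverU-liWeight lam p m = trans (cong (λ c → divPow c m p) coefficient) (divPow-*ˡ (sgn m * inv! m) _ m p)
  where
  regroup : ∀ s l f i → s * l * f * i ≡ s * i * (l * f)
  regroup = solve-∀ ℚ-ring
  coefficient : (- lam) ^ℕ m * fall (1/ lam) 1ℚ (suc m) * inv! m ≡ sgn m * inv! m * (lam ^ℕ m * fall (1/ lam) 1ℚ (suc m))
  coefficient = trans (cong (λ z → z * fall (1/ lam) 1ℚ (suc m) * inv! m) (-^ℕ lam m))
                      (regroup (sgn m) (lam ^ℕ m) (fall (1/ lam) 1ℚ (suc m)) (inv! m))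

module DegenerateStirling (lam : ℚ) (S2 : ℕ → ℕ → ℚ)
  (S2-expand : ∀ n x → fall lam x n ≡ Σ≤ n (λ k → S2 n k * fall 1ℚ x k))
  (S2-vanish : ∀ n k → n ℕ.< k → S2 n k ≡ 0ℚ) where

  S2-expand-≤ : ∀ {n M} x → n ℕ.≤ M → fall lam x n ≡ Σ≤ M (λ k → S2 n k * fall 1ℚ x k)
  S2-expand-≤ {n} {M} x n≤M = trans (S2-expand n x) (sym (Σ≤-extend _ n≤M high≡0))
    where
    high≡0 : ∀ k → n ℕ.< k → k ℕ.≤ M → S2 n k * fall 1ℚ x k ≡ 0ℚ
    high≡0 k n<k _ = trans (cong (_* fall 1ℚ x k) (S2-vanish n k n<k)) (ℚP.*-zeroˡ (fall 1ℚ x k))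

  S2-expand-Σ : ∀ N M (w : ℕ → ℚ) (ι : ℕ → ℕ) → (∀ j → j ℕ.≤ N → ι j ℕ.≤ M) → ∀ x →
    Σ≤ M (λ k → Σ≤ N (λ j → w j * S2 (ι j) k) * fall 1ℚ x k) ≡ Σ≤ N (λ j → w j * fall lam x (ι j))
  S2-expand-Σ N M w ι ι≤M x = begin
    Σ≤ M (λ k → Σ≤ N (λ j → w j * S2 (ι j) k) * ff k)
      ≡⟨ Σ≤-cong M (λ k _ → Σ≤-* N (ff k) _) ⟩
    Σ≤ M (λ k → Σ≤ N (λ j → w j * S2 (ι j) k * ff k))
      ≡⟨ Σ≤-swap M N _ ⟩
    Σ≤ N (λ j → Σ≤ M (λ k → w j * S2 (ι j) k * ff k))
      ≡⟨ Σ≤-cong N (λ j _ → trans (Σ≤-cong M (λ k _ → ℚP.*-assoc (w j) _ _)) (sym (*-Σ≤ M (w j) _))) ⟩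
    Σ≤ N (λ j → w j * Σ≤ M (λ k → S2 (ι j) k * ff k))
      ≡⟨ Σ≤-cong N (λ j j≤N → cong (w j *_) (S2-expand-≤ x (ι≤M j j≤N))) ⟨
    Σ≤ N (λ j → w j * fall lam x (ι j))
      ∎
    where
    ff : ℕ → ℚ
    ff = fall 1ℚ x

  S2[n,0]≡one : ∀ n → S2 n 0 ≡ one n
  S2[n,0]≡one n = begin
    S2 n 0                              ≡⟨ Σ≤-*one n (S2 n) ⟨
    Σ≤ n (λ k → S2 n k * one k)         ≡⟨ Σ≤-cong n (λ k _ → cong (S2 n k *_) (fall-0 1ℚ k)) ⟨
    Σ≤ n (λ k → S2 n k * fall 1ℚ 0ℚ k)  ≡⟨ S2-expand n 0ℚ ⟨
    fall lam 0ℚ n                       ≡⟨ fall-0 lam n ⟩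
    one n                               ∎

  S2-recurrence : ∀ N m → Σ≤ N (λ j → binom N j * fall lam 1ℚ j * S2 (N ∸ j) m) ≡ S2 N m + ℕ→ℚ (suc m) * S2 N (suc m)
  S2-recurrence N m with ℕP.≤-<-connex m N
  ... | inj₁ m≤N = fall-coeffs-injective N (λ k → Σ≤ N (λ j → binom N j * fall lam 1ℚ j * S2 (N ∸ j) k))
                                          (λ k → S2 N k + ℕ→ℚ (suc k) * S2 N (suc k)) expansions m m≤N
    where
    expansions : ∀ x → Σ≤ N (λ k → Σ≤ N (λ j → binom N j * fall lam 1ℚ j * S2 (N ∸ j) k) * fall 1ℚ (ℕ→ℚ x) k)
                     ≡ Σ≤ N (λ k → (S2 N k + ℕ→ℚ (suc k) * S2 N (suc k)) * fall 1ℚ (ℕ→ℚ x) k)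
    expansions x = begin
      Σ≤ N (λ k → Σ≤ N (λ j → binom N j * fall lam 1ℚ j * S2 (N ∸ j) k) * fall 1ℚ X k)
        ≡⟨ S2-expand-Σ N N (λ j → binom N j * fall lam 1ℚ j) (N ∸_) (λ j _ → ℕP.m∸n≤m N j) X ⟩
      Σ≤ N (λ j → binom N j * fall lam 1ℚ j * fall lam X (N ∸ j))
        ≡⟨ fall-vandermonde lam 1ℚ X N ⟨
      fall lam (1ℚ + X) N
        ≡⟨ S2-expand N (1ℚ + X) ⟩
      Σ≤ N (λ k → S2 N k * fall 1ℚ (1ℚ + X) k)
        ≡⟨ Σ≤-fall-1+x N (S2 N) (S2-vanish N (suc N) (ℕP.n<1+n N)) X ⟩
      Σ≤ N (λ k → (S2 N k + ℕ→ℚ (suc k) * S2 N (suc k)) * fall 1ℚ X k)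
        ∎
      where
      X : ℚ
      X = ℕ→ℚ x
  ... | inj₂ N<m = begin
    Σ≤ N (λ j → binom N j * fall lam 1ℚ j * S2 (N ∸ j) m)
      ≡⟨ Σ≤-zero N (λ j _ → trans (cong (binom N j * fall lam 1ℚ j *_) (S2-vanish (N ∸ j) m (N∸j<m j)))
                                  (ℚP.*-zeroʳ (binom N j * fall lam 1ℚ j))) ⟩
    0ℚ
      ≡⟨ zero-sum (ℕ→ℚ (suc m)) ⟩
    0ℚ + ℕ→ℚ (suc m) * 0ℚ
      ≡⟨ cong₂ (λ a b → a + ℕ→ℚ (suc m) * b) (S2-vanish N m N<m) (S2-vanish N (suc m) (ℕP.m<n⇒m<1+n N<m)) ⟨
    S2 N m + ℕ→ℚ (suc m) * S2 N (suc m)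
      ∎
    where
    N∸j<m : ∀ j → N ∸ j ℕ.< m
    N∸j<m j = ℕP.≤-<-trans (ℕP.m∸n≤m N j) N<m
    zero-sum : ∀ a → 0ℚ ≡ 0ℚ + a * 0ℚ
    zero-sum = solve-∀ ℚ-ring

  egfCoeff-ySeries^ : ∀ m N → egfCoeff (ySeries lam ^S m) N ≡ sgn m * sgn N * ℕ→ℚ (m !) * S2 N m
  egfCoeff-ySeries^ zero    zero    = cong (1ℚ * 1ℚ * 1ℚ *_) (sym (S2[n,0]≡one 0))
  egfCoeff-ySeries^ zero    (suc N) = trans (ℚP.*-zeroʳ (ℕ→ℚ (suc N !)))
    (sym (trans (cong (sgn 0 * sgn (suc N) * ℕ→ℚ (0 !) *_) (S2[n,0]≡one (suc N))) (ℚP.*-zeroʳ (sgn 0 * sgn (suc N) * ℕ→ℚ (0 !)))))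
  egfCoeff-ySeries^ (suc m) N = begin
    egfCoeff (ySeries lam ⊛ (ySeries lam ^S m)) N
      ≡⟨ egfCoeff-ySeries-⊛ lam (ySeries lam ^S m) N ⟩
    G N - Σ≤ N (λ j → sgn j * (b j * G (N ∸ j)))
      ≡⟨ cong₂ _-_ (egfCoeff-ySeries^ m N) (Σ≤-cong N sign-out) ⟩
    c * S2 N m - Σ≤ N (λ j → c * (b j * S2 (N ∸ j) m))
      ≡⟨ cong (λ z → c * S2 N m - z) (*-Σ≤ N c _) ⟨
    c * S2 N m - c * Σ≤ N (λ j → b j * S2 (N ∸ j) m)
      ≡⟨ cong (λ z → c * S2 N m - c * z) (S2-recurrence N m) ⟩
    c * S2 N m - c * (S2 N m + ℕ→ℚ (suc m) * S2 N (suc m))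
      ≡⟨ cancel (sgn m) (sgn N) (ℕ→ℚ (m !)) (S2 N m) (ℕ→ℚ (suc m)) (S2 N (suc m)) ⟩
    (- 1ℚ) * sgn m * sgn N * (ℕ→ℚ (suc m) * ℕ→ℚ (m !)) * S2 N (suc m)
      ≡⟨ cong (λ z → (- 1ℚ) * sgn m * sgn N * z * S2 N (suc m)) (ℕ→ℚ-* (suc m) (m !)) ⟨
    sgn (suc m) * sgn N * ℕ→ℚ (suc m !) * S2 N (suc m)
      ∎
    where
    G b : ℕ → ℚ
    G = egfCoeff (ySeries lam ^S m)
    b j = binom N j * fall lam 1ℚ j
    c : ℚ
    c = sgn m * sgn N * ℕ→ℚ (m !)
    cancel : ∀ s t a u k v → s * t * a * u - s * t * a * (u + k * v) ≡ (- 1ℚ) * s * t * (k * a) * v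
    cancel = solve-∀ ℚ-ring
    regroup : ∀ s b t u a v → s * (b * (t * u * a * v)) ≡ t * (s * u) * a * (b * v)
    regroup = solve-∀ ℚ-ring
    sign-out : ∀ j → j ℕ.≤ N → sgn j * (b j * G (N ∸ j)) ≡ c * (b j * S2 (N ∸ j) m)
    sign-out j j≤N = begin
      sgn j * (b j * G (N ∸ j))
        ≡⟨ cong (λ g → sgn j * (b j * g)) (egfCoeff-ySeries^ m (N ∸ j)) ⟩
      sgn j * (b j * (sgn m * sgn (N ∸ j) * ℕ→ℚ (m !) * S2 (N ∸ j) m))
        ≡⟨ regroup (sgn j) (b j) (sgn m) (sgn (N ∸ j)) (ℕ→ℚ (m !)) (S2 (N ∸ j) m) ⟩
      sgn m * (sgn j * sgn (N ∸ j)) * ℕ→ℚ (m !) * (b j * S2 (N ∸ j) m)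
        ≡⟨ cong (λ s → sgn m * s * ℕ→ℚ (m !) * (b j * S2 (N ∸ j) m)) (sgn-∸ j≤N) ⟩
      c * (b j * S2 (N ∸ j) m)
        ∎

  egfCoeff-Li∘y : .{{_ : NonZero lam}} → ∀ p {N M} → N ℕ.≤ M →
    egfCoeff (compose (LiOverU lam p) (ySeries lam)) N ≡ sgn N * Σ≤ M (λ m → liWeight lam p m * S2 N m)
  egfCoeff-Li∘y p {N} {M} N≤M = begin
    ℕ→ℚ (N !) * Σ≤ N (λ m → LiOverU lam p m * (ySeries lam ^S m) N)   ≡⟨ *-Σ≤ N (ℕ→ℚ (N !)) _ ⟩
    Σ≤ N (λ m → ℕ→ℚ (N !) * (LiOverU lam p m * (ySeries lam ^S m) N)) ≡⟨ Σ≤-cong N (λ m _ → term m) ⟩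
    Σ≤ N (λ m → sgn N * (w m * S2 N m))                               ≡⟨ *-Σ≤ N (sgn N) _ ⟨
    sgn N * Σ≤ N (λ m → w m * S2 N m)                                 ≡⟨ cong (sgn N *_) (Σ≤-extend _ N≤M high≡0) ⟨
    sgn N * Σ≤ M (λ m → w m * S2 N m)                                 ∎
    where
    w : ℕ → ℚ
    w = liWeight lam p
    high≡0 : ∀ m → N ℕ.< m → m ℕ.≤ M → w m * S2 N m ≡ 0ℚ
    high≡0 m N<m _ = trans (cong (w m *_) (S2-vanish N m N<m)) (ℚP.*-zeroʳ (w m))
    swap : ∀ a b c → a * (b * c) ≡ b * (a * c)
    swap = solve-∀ ℚ-ring
    regroup : ∀ s i w t f u → s * i * w * (s * t * f * u) ≡ s * s * (i * f) * (t * (w * u))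
    regroup = solve-∀ ℚ-ring
    term : ∀ m → ℕ→ℚ (N !) * (LiOverU lam p m * (ySeries lam ^S m) N) ≡ sgn N * (w m * S2 N m)
    term m = begin
      ℕ→ℚ (N !) * (LiOverU lam p m * (ySeries lam ^S m) N)
        ≡⟨ swap (ℕ→ℚ (N !)) (LiOverU lam p m) ((ySeries lam ^S m) N) ⟩
      LiOverU lam p m * egfCoeff (ySeries lam ^S m) N
        ≡⟨ cong₂ _*_ (LiOverU-liWeight lam p m) (egfCoeff-ySeries^ m N) ⟩
      sgn m * inv! m * w m * (sgn m * sgn N * ℕ→ℚ (m !) * S2 N m)
        ≡⟨ regroup (sgn m) (inv! m) (w m) (sgn N) (ℕ→ℚ (m !)) (S2 N m) ⟩
      sgn m * sgn m * (inv! m * ℕ→ℚ (m !)) * (sgn N * (w m * S2 N m))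
        ≡⟨ cong₂ (λ a b → a * b * (sgn N * (w m * S2 N m))) (sgn*sgn m) (inv!-inverseˡ m) ⟩
      1ℚ * 1ℚ * (sgn N * (w m * S2 N m))
        ≡⟨ ℚP.*-identityˡ (sgn N * (w m * S2 N m)) ⟩
      sgn N * (w m * S2 N m)
        ∎

  polyBernoulli-neg : .{{_ : NonZero lam}} → ∀ p x n →
    polyBernoulli lam p n (- x) ≡ sgn n * Σ≤ n (λ k → liWeight lam p k * Σ≤ n (λ j → binom n j * S2 j k * fall lam x (n ∸ j)))
  polyBernoulli-neg p x n = begin
    egfCoeff (Li∘y ⊛ negT (eSeries lam (- - x))) n
      ≡⟨ egfCoeff-⊛ Li∘y (negT (eSeries lam (- - x))) n ⟩
    Σ≤ n (λ j → binom n j * egfCoeff Li∘y j * egfCoeff (negT (eSeries lam (- - x))) (n ∸ j))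
      ≡⟨ Σ≤-cong n term ⟩
    Σ≤ n (λ j → sgn n * Σ≤ n (λ k → w k * (binom n j * S2 j k * fall lam x (n ∸ j))))
      ≡⟨ *-Σ≤ n (sgn n) _ ⟨
    sgn n * Σ≤ n (λ j → Σ≤ n (λ k → w k * (binom n j * S2 j k * fall lam x (n ∸ j))))
      ≡⟨ cong (sgn n *_) (Σ≤-swap n n _) ⟩
    sgn n * Σ≤ n (λ k → Σ≤ n (λ j → w k * (binom n j * S2 j k * fall lam x (n ∸ j))))
      ≡⟨ cong (sgn n *_) (Σ≤-cong n (λ k _ → *-Σ≤ n (w k) _)) ⟨
    sgn n * Σ≤ n (λ k → w k * Σ≤ n (λ j → binom n j * S2 j k * fall lam x (n ∸ j)))
      ∎
    where
    Li∘y : Series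
    Li∘y = compose (LiOverU lam p) (ySeries lam)
    w : ℕ → ℚ
    w = liWeight lam p
    neg-neg : ∀ x → - (- x) ≡ x
    neg-neg = solve-∀ ℚ-ring
    regroup : ∀ b s σ t f → b * (s * σ) * (t * f) ≡ s * t * (σ * (b * f))
    regroup = solve-∀ ℚ-ring
    regroup′ : ∀ w s b f → w * s * (b * f) ≡ w * (b * s * f)
    regroup′ = solve-∀ ℚ-ring
    term : ∀ j → j ℕ.≤ n →
      binom n j * egfCoeff Li∘y j * egfCoeff (negT (eSeries lam (- - x))) (n ∸ j)
        ≡ sgn n * Σ≤ n (λ k → w k * (binom n j * S2 j k * fall lam x (n ∸ j)))
    term j j≤n = begin
      binom n j * egfCoeff Li∘y j * egfCoeff (negT (eSeries lam (- - x))) (n ∸ j)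
        ≡⟨ cong₂ (λ a e → binom n j * a * e) (egfCoeff-Li∘y p j≤n) (egfCoeff-negT-eSeries lam (- - x) (n ∸ j)) ⟩
      binom n j * (sgn j * σ) * (sgn (n ∸ j) * fall lam (- - x) (n ∸ j))
        ≡⟨ cong (λ z → binom n j * (sgn j * σ) * (sgn (n ∸ j) * fall lam z (n ∸ j))) (neg-neg x) ⟩
      binom n j * (sgn j * σ) * (sgn (n ∸ j) * F)
        ≡⟨ regroup (binom n j) (sgn j) σ (sgn (n ∸ j)) F ⟩
      sgn j * sgn (n ∸ j) * (σ * (binom n j * F))
        ≡⟨ cong (λ s → s * (σ * (binom n j * F))) (sgn-∸ j≤n) ⟩
      sgn n * (σ * (binom n j * F))
        ≡⟨ cong (sgn n *_) (trans (Σ≤-* n (binom n j * F) _) (Σ≤-cong n (λ k _ → regroup′ (w k) (S2 j k) (binom n j) F))) ⟩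
      sgn n * Σ≤ n (λ k → w k * (binom n j * S2 j k * F))
        ∎
      where
      σ F : ℚ
      σ = Σ≤ n (λ k → w k * S2 j k)
      F = fall lam x (n ∸ j)

  S2-shifted-coeffs : ∀ y n (c : ℕ → ℚ) → (∀ x → fall lam (x + y) n ≡ Σ≤ n (λ k → c k * fall 1ℚ x k)) →
    ∀ k → k ℕ.≤ n → Σ≤ n (λ j → binom n j * S2 j k * fall lam y (n ∸ j)) ≡ c k
  S2-shifted-coeffs y n c expand-c = fall-coeffs-injective n (λ k → Σ≤ n (λ j → binom n j * S2 j k * fall lam y (n ∸ j))) c expansions
    where
    swap₂₃ : ∀ a b c → a * b * c ≡ a * c * b
    swap₂₃ = solve-∀ ℚ-ring
    expansions : ∀ x → Σ≤ n (λ k → Σ≤ n (λ j → binom n j * S2 j k * fall lam y (n ∸ j)) * fall 1ℚ (ℕ→ℚ x) k)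
                     ≡ Σ≤ n (λ k → c k * fall 1ℚ (ℕ→ℚ x) k)
    expansions x = begin
      Σ≤ n (λ k → Σ≤ n (λ j → binom n j * S2 j k * fall lam y (n ∸ j)) * fall 1ℚ X k)
        ≡⟨ Σ≤-cong n (λ k _ → cong (_* fall 1ℚ X k) (Σ≤-cong n (λ j _ → swap₂₃ (binom n j) (S2 j k) (fall lam y (n ∸ j))))) ⟩
      Σ≤ n (λ k → Σ≤ n (λ j → binom n j * fall lam y (n ∸ j) * S2 j k) * fall 1ℚ X k)
        ≡⟨ S2-expand-Σ n n (λ j → binom n j * fall lam y (n ∸ j)) (λ j → j) (λ _ j≤n → j≤n) X ⟩
      Σ≤ n (λ j → binom n j * fall lam y (n ∸ j) * fall lam X j)
        ≡⟨ Σ≤-cong n (λ j _ → swap₂₃ (binom n j) (fall lam y (n ∸ j)) (fall lam X j)) ⟩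
      Σ≤ n (λ j → binom n j * fall lam X j * fall lam y (n ∸ j))
        ≡⟨ fall-vandermonde lam X y n ⟨
      fall lam (X + y) n
        ≡⟨ expand-c X ⟩
      Σ≤ n (λ k → c k * fall 1ℚ X k)
        ∎
      where
      X : ℚ
      X = ℕ→ℚ x

theorem10 : (lam : ℚ) → .{{_ : NonZero lam}} → (r : ℕ) → (p : ℤ) →
    -- S2 n k = S_{2,λ}(n,k): (x)_{n,λ} = Σ_{k=0}^{n} S_{2,λ}(n,k) (x)_k, and 0 for k > n
    (S2 : ℕ → ℕ → ℚ) →
    (∀ n x → fall lam x n ≡ Σ≤ n (λ k → S2 n k * fall 1ℚ x k)) →
    (∀ n k → n ℕ.< k → S2 n k ≡ 0ℚ) →
    -- S2r = S^{(r)}_{2,λ}: (x+r)_{n,λ} = Σ_{k=0}^{n} S^{(r)}_{2,λ}(n+r,k+r) (x)_k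
    (S2r : ℕ → ℕ → ℚ) →
    (∀ n x → fall lam (x + ℕ→ℚ r) n ≡ Σ≤ n (λ k → S2r (n ℕ.+ r) (k ℕ.+ r) * fall 1ℚ x k)) →
    (n : ℕ) →
    (polyBernoulli lam p n (- ℕ→ℚ r)
       ≡ ((- 1ℚ) ^ℕ n) * Σ≤ n (λ k → divPow ((lam ^ℕ k) * fall (1/ lam) 1ℚ (suc k)) k p
                                      * Σ≤ n (λ j → binom n j * S2 j k * fall lam (ℕ→ℚ r) (n ∸ j))))
    × (((- 1ℚ) ^ℕ n) * Σ≤ n (λ k → divPow ((lam ^ℕ k) * fall (1/ lam) 1ℚ (suc k)) k p
                                      * Σ≤ n (λ j → binom n j * S2 j k * fall lam (ℕ→ℚ r) (n ∸ j)))
       ≡ ((- 1ℚ) ^ℕ n) * Σ≤ n (λ k → divPow ((lam ^ℕ k) * fall (1/ lam) 1ℚ (suc k)) k p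
                                      * S2r (n ℕ.+ r) (k ℕ.+ r)))
theorem10 lam r p S2 S2-expand S2-vanish S2r S2r-expand n =
    polyBernoulli-neg p (ℕ→ℚ r) n
  , cong (sgn n *_) (Σ≤-cong n (λ k k≤n → cong (liWeight lam p k *_) (r-Stirling k k≤n)))
  where
  open DegenerateStirling lam S2 S2-expand S2-vanish
  r-Stirling : ∀ k → k ℕ.≤ n → Σ≤ n (λ j → binom n j * S2 j k * fall lam (ℕ→ℚ r) (n ∸ j)) ≡ S2r (n ℕ.+ r) (k ℕ.+ r)
  r-Stirling = S2-shifted-coeffs (ℕ→ℚ r) n (λ k → S2r (n ℕ.+ r) (k ℕ.+ r)) (S2r-expand n)
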